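{- As formal power series in $z$, \[ \frac{{}_1\phi_1(0;cq;q,qz)}{{}_1\phi_1(0;c;q,z)} = \cfrac{1}{1-b_0z - \cfrac{a_1z}{1-b_1z-\cfrac{a_2z}{1-b_2z-\cdots}}} = \cfrac{1}{1-\cfrac{\lambda_1z}{1-\cfrac{\lambda_2z}{1-\cdots}}}, \] where \[ a_i = \frac{cq^{2i-1}}{(1-cq^{i-1})(1-cq^{i})}, \qquad b_i = \frac{q^{i}}{1-cq^{i}}, \] \[ \lambda_{2i} = \frac{cq^{3i-1}}{(1-cq^{2i-1})(1-cq^{2i})}, \qquad \lambda_{2i+1} = \frac{q^{i}}{(1-cq^{2i})(1-cq^{2i+1})}. \]
   Context: $(x;q)_n=(1-x)(1-xq)\cdots(1-xq^{n-1})$ and ${}_1\phi_1(0;c;q,z)=\sum_{n\ge0}\frac{(-1)^nq^{\binom n2}}{(q;q)_n(c;q)_n}z^n$. -}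

module Defs where

open import Level using (Level)
open import Algebra.Bundles using (CommutativeRing)
open import Data.Nat using (ℕ; zero; suc; _∸_) renaming (_+_ to _+ℕ_; _*_ to _*ℕ_)
open import Data.Nat.Combinatorics using (_C_)
open import Data.Bool using (Bool; true; false; if_then_else_)
open import Data.Product using (_×_; _,_)

module QCF {a ℓ : Level} (R : CommutativeRing a ℓ) where

  open CommutativeRing R hiding (zero)

  infixr 8 _^_
  infixl 6 _−_
  _^_ : Carrier → ℕ → Carrier
  x ^ zero  = 1#
  x ^ suc n = x * (x ^ n)

  _−_ : Carrier → Carrier → Carrier
  x − y = x + (- y)

  Series : Set a
  Series = ℕ → Carrier

  sumBelow : (ℕ → Carrier) → ℕ → Carrier
  sumBelow f zero    = 0#
  sumBelow f (suc n) = sumBelow f n + f n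

  prodBelow : (ℕ → Carrier) → ℕ → Carrier
  prodBelow f zero    = 1#
  prodBelow f (suc n) = prodBelow f n * f n

  qPoch : Carrier → Carrier → ℕ → Carrier
  qPoch x q n = prodBelow (λ j → 1# − x * (q ^ j)) n

  const : Carrier → Series
  const x zero    = x
  const x (suc n) = 0#

  one : Series
  one = const 1#

  _⊕_ : Series → Series → Series
  (f ⊕ g) n = f n + g n

  scale : Carrier → Series → Series
  scale x f n = x * f n

  _⊛_ : Series → Series → Series
  (f ⊛ g) n = sumBelow (λ k → f k * g (n ∸ k)) (suc n)

  pow : Series → ℕ → Series
  pow f zero    = one
  pow f (suc m) = f ⊛ pow f m

  zmul : Series → Series
  zmul f zero    = 0#
  zmul f (suc n) = f n

  -- 1 / (1 - z h) = Σ_m (z h)^m  (coefficient n only needs m ≤ n)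
  inv1m : Series → Series
  inv1m h n = sumBelow (λ m → pow (zmul h) m n) (suc n)

  -- reciprocal of a series f with f 0 = 1:  f = 1 - z h  with  h n = - f (n+1)
  recip1 : Series → Series
  recip1 f = inv1m (λ n → - f (suc n))

  -- Truncated J-fraction starting at level k with d further levels:
  --   1/(1 - b_k z - a_{k+1} z /(1 - b_{k+1} z - ... /(1 - b_{k+d} z)))
  Jtail : (ℕ → Carrier) → (ℕ → Carrier) → ℕ → ℕ → Series
  Jtail b a zero    k = inv1m (const (b k))
  Jtail b a (suc d) k = inv1m (const (b k) ⊕ scale (a (suc k)) (Jtail b a d (suc k)))

  -- The infinite J-fraction 1/(1 - b_0 z - a_1 z/(1 - b_1 z - ...)) as a formal
  -- power series: its z^n coefficient is that of any truncation of depth ≥ n.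
  Jfrac : (ℕ → Carrier) → (ℕ → Carrier) → Series
  Jfrac b a n = Jtail b a n zero n

  -- Truncated S-fraction from level k, d levels:
  --   1/(1 - λ_k z /(1 - λ_{k+1} z / ... /(1 - λ_{k+d-1} z)))  (d = 0 gives 1)
  Stail : (ℕ → Carrier) → ℕ → ℕ → Series
  Stail lam zero    k = one
  Stail lam (suc d) k = inv1m (scale (lam k) (Stail lam d (suc k)))

  Sfrac : (ℕ → Carrier) → Series
  Sfrac lam n = Stail lam (suc n) 1 n

  -- n = 2 i + (if bit then 1 else 0)
  split2 : ℕ → ℕ × Bool
  split2 zero = 0 , false
  split2 (suc n) with split2 n
  ... | i , false = i , true
  ... | i , true  = suc i , false

  -- In what follows  ic k  is the inverse of (1 - c q^k)  and  iq k  the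
  -- inverse of (1 - q^{k+1})  (this is imposed as a hypothesis in the statement).
  module _ (c q : Carrier) (ic iq : ℕ → Carrier) where

    invQQ : ℕ → Carrier
    invQQ n = prodBelow iq n

    invCQ : ℕ → Carrier
    invCQ n = prodBelow ic n

    invCqQ : ℕ → Carrier
    invCqQ n = prodBelow (λ j → ic (suc j)) n

    phiDen : Series
    phiDen n = ((- 1#) ^ n) * (q ^ (n C 2)) * invQQ n * invCQ n

    phiNum : Series
    phiNum n = ((- 1#) ^ n) * (q ^ (n C 2)) * invQQ n * invCqQ n * (q ^ n)

    ratio : Series
    ratio = phiNum ⊛ recip1 phiDen

    -- a_i = c q^{2i-1} / ((1-cq^{i-1})(1-cq^i))   (i ≥ 1; a_0 unused)
    aCoef : ℕ → Carrier
    aCoef zero    = 0#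
    aCoef (suc j) = c * (q ^ suc (2 *ℕ j)) * ic j * ic (suc j)

    bCoef : ℕ → Carrier
    bCoef i = (q ^ i) * ic i

    -- λ_{2i} = c q^{3i-1}/((1-cq^{2i-1})(1-cq^{2i}))   (i ≥ 1; λ_0 unused)
    lamEven : ℕ → Carrier
    lamEven zero    = 0#
    lamEven (suc j) = c * (q ^ suc (3 *ℕ j +ℕ 1)) * ic (suc (2 *ℕ j)) * ic (2 *ℕ j +ℕ 2)

    lamOdd : ℕ → Carrier
    lamOdd i = (q ^ i) * ic (2 *ℕ i) * ic (suc (2 *ℕ i))

    lamCoef : ℕ → Carrier
    lamCoef n with split2 n
    ... | i , false = lamEven i
    ... | i , true  = lamOdd i

-- Write F(A, B) = 1φ1(0; c q^A; q, q^B z).  Comparing coefficients gives three-term contiguous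
-- relations such as F(A+1, B+1) = F(A, B) + z q^B / ((1 - c q^A)(1 - c q^(A+1))) F(A+2, B+1);
-- once the common factors of the three coefficients are cancelled, each relation is the
-- partial-fraction identity 1/((1-x)(1-y)) = (1/(1-xy)) (1/(1-y) + x/(1-x)).
-- A family with g(k+1) = g(k) + β(k) z g(k+1) + α(k) z g(k+2) and g(k)(0) = 1 satisfies
-- g(k+1)/g(k) = 1/(1 - β(k) z - α(k) z g(k+2)/g(k+1)); unfolding this d times gives the continued
-- fraction for g(1)/g(0) correctly up to z^d.  The families g(k) = F(k, k) and g(k) = F(k, ⌈k/2⌉)
-- give the J-fraction and the S-fraction.

module Submission where

open import Level using (Level)
open import Algebra.Bundles using (CommutativeRing)
open import Data.Nat using (ℕ; zero; suc; _≤_; _<_; _≤′_; ≤′-refl; ≤′-step; s≤s; _∸_; ⌈_/2⌉)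
  renaming (_+_ to _+ℕ_; _*_ to _*ℕ_)
open import Data.Nat.Combinatorics using (_C_; nC1≡n; nCk+nC[k+1]≡[n+1]C[k+1])
import Data.Nat.Properties as ℕ
open import Function using (_∘_)
open import Data.Nat.Tactic.RingSolver using (solve-∀)
open import Data.Bool using (false)
open import Data.Product using (_×_; _,_)
open import Relation.Binary.PropositionalEquality as ≡ using (_≡_)
import Relation.Binary.Reasoning.Setoid as SetoidReasoning

open import Defs

parity-induction : ∀ {p} {P : ℕ → ℕ → ℕ → Set p} →
                   (∀ m → P (2 *ℕ m) m (suc m)) → (∀ m → P (suc (2 *ℕ m)) (suc m) (suc m)) →
                   ∀ k → P k ⌈ k /2⌉ ⌈ suc k /2⌉
parity-induction         even odd zero          = even 0
parity-induction         even odd (suc zero)    = odd 0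
parity-induction {P = P} even odd (suc (suc k)) =
  parity-induction {P = λ k B B′ → P (suc (suc k)) (suc B) (suc B′)}
    (λ m → ≡.subst (λ k → P k (suc m) (suc (suc m))) (ℕ.*-suc 2 m) (even (suc m)))
    (λ m → ≡.subst (λ k → P (suc k) (suc (suc m)) (suc (suc m))) (ℕ.*-suc 2 m) (odd (suc m))) k

module _ {a ℓ : Level} (R : CommutativeRing a ℓ) where
  open CommutativeRing R hiding (zero)
  open QCF R
  open SetoidReasoning setoid
  open import Algebra.Properties.Ring ring using (-1*x≈-x; -‿involutive; -‿distribˡ-*)
  open import Algebra.Properties.AbelianGroup +-abelianGroup using (x≈z//y; //-rightDividesˡ; ⁻¹-anti-homo-∙)
  open import Algebra.Properties.CommutativeSemigroup *-commutativeSemigroup using (x∙yz≈y∙xz)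
  open import Algebra.Properties.CommutativeSemigroup +-commutativeSemigroup
    using () renaming (interchange to +-interchange)
  open import Algebra.Solver.Ring.NaturalCoefficients.Default commutativeSemiring
    using (solve; _:+_; _:*_; _:=_; con)

  tail : Series → Series
  tail f n = f (suc n)

  sumBelow-cong : ∀ {f g : ℕ → Carrier} n → (∀ k → k < n → f k ≈ g k) → sumBelow f n ≈ sumBelow g n
  sumBelow-cong zero    f≈g = refl
  sumBelow-cong (suc n) f≈g = +-cong (sumBelow-cong n (λ k k<n → f≈g k (ℕ.m≤n⇒m≤1+n k<n))) (f≈g n ℕ.≤-refl)

  sumBelow-head : ∀ (f : ℕ → Carrier) n → sumBelow f (suc n) ≈ f 0 + sumBelow (f ∘ suc) n
  sumBelow-head f zero    = trans (+-identityˡ _) (sym (+-identityʳ _))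
  sumBelow-head f (suc n) = trans (+-congʳ (sumBelow-head f n)) (+-assoc _ _ _)

  sumBelow-+ : ∀ (f g : ℕ → Carrier) n → sumBelow (λ k → f k + g k) n ≈ sumBelow f n + sumBelow g n
  sumBelow-+ f g zero    = sym (+-identityˡ _)
  sumBelow-+ f g (suc n) = trans (+-congʳ (sumBelow-+ f g n))
    (+-interchange _ _ _ _)

  sumBelow-distribˡ : ∀ x (f : ℕ → Carrier) n → sumBelow (λ k → x * f k) n ≈ x * sumBelow f n
  sumBelow-distribˡ x f zero    = sym (zeroʳ x)
  sumBelow-distribˡ x f (suc n) = trans (+-congʳ (sumBelow-distribˡ x f n)) (sym (distribˡ _ _ _))

  sumBelow-zero : ∀ {f : ℕ → Carrier} n → (∀ k → k < n → f k ≈ 0#) → sumBelow f n ≈ 0#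
  sumBelow-zero zero    f≈0 = refl
  sumBelow-zero (suc n) f≈0 =
    trans (+-cong (sumBelow-zero n (λ k k<n → f≈0 k (ℕ.m≤n⇒m≤1+n k<n))) (f≈0 n ℕ.≤-refl)) (+-identityˡ 0#)

  sumBelow-truncate : ∀ (f : ℕ → Carrier) {j n} → j ≤ n → (∀ k → j < k → f k ≈ 0#) →
                      sumBelow f (suc n) ≈ sumBelow f (suc j)
  sumBelow-truncate f {j} j≤n f≈0 = go (ℕ.≤⇒≤′ j≤n)
    where
    go : ∀ {n} → j ≤′ n → sumBelow f (suc n) ≈ sumBelow f (suc j)
    go ≤′-refl           = refl
    go (≤′-step j≤′n) = trans (+-cong (go j≤′n) (f≈0 _ (s≤s (ℕ.≤′⇒≤ j≤′n)))) (+-identityʳ _)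

  const-0# : ∀ n → const 0# n ≈ 0#
  const-0# zero    = refl
  const-0# (suc n) = refl

  ⊛-zeroth : ∀ f g → (f ⊛ g) 0 ≈ f 0 * g 0
  ⊛-zeroth f g = +-identityˡ _

  ⊛-sucˡ : ∀ f g n → (f ⊛ g) (suc n) ≈ f 0 * g (suc n) + (tail f ⊛ g) n
  ⊛-sucˡ f g n = sumBelow-head (λ k → f k * g (suc n ∸ k)) (suc n)

  ⊛-sucʳ : ∀ f g n → (f ⊛ g) (suc n) ≈ (f ⊛ tail g) n + f (suc n) * g 0
  ⊛-sucʳ f g n = +-cong
    (sumBelow-cong (suc n) (λ k k≤n → *-congˡ (reflexive (≡.cong g (ℕ.+-∸-assoc 1 (ℕ.≤-pred k≤n))))))
    (*-congˡ (reflexive (≡.cong g (ℕ.n∸n≡0 n))))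

  ⊛-cong : ∀ {f f′ g g′} n → (∀ k → k ≤ n → f k ≈ f′ k) → (∀ k → k ≤ n → g k ≈ g′ k) →
           (f ⊛ g) n ≈ (f′ ⊛ g′) n
  ⊛-cong n f≈f′ g≈g′ =
    sumBelow-cong (suc n) (λ k k≤n → *-cong (f≈f′ k (ℕ.≤-pred k≤n)) (g≈g′ (n ∸ k) (ℕ.m∸n≤m n k)))

  ⊛-congˡ : ∀ f {g g′} n → (∀ k → k ≤ n → g k ≈ g′ k) → (f ⊛ g) n ≈ (f ⊛ g′) n
  ⊛-congˡ f n = ⊛-cong {f = f} n (λ _ _ → refl)

  ⊛-congʳ : ∀ {f f′} g n → (∀ k → k ≤ n → f k ≈ f′ k) → (f ⊛ g) n ≈ (f′ ⊛ g) n
  ⊛-congʳ g n f≈f′ = ⊛-cong {g = g} n f≈f′ (λ _ _ → refl)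

  ⊛-comm : ∀ f g n → (f ⊛ g) n ≈ (g ⊛ f) n
  ⊛-comm f g zero    = trans (⊛-zeroth f g) (trans (*-comm _ _) (sym (⊛-zeroth g f)))
  ⊛-comm f g (suc n) = begin
    (f ⊛ g) (suc n)                 ≈⟨ ⊛-sucˡ f g n ⟩
    f 0 * g (suc n) + (tail f ⊛ g) n ≈⟨ +-cong (*-comm _ _) (⊛-comm (tail f) g n) ⟩
    g (suc n) * f 0 + (g ⊛ tail f) n ≈⟨ +-comm _ _ ⟩
    (g ⊛ tail f) n + g (suc n) * f 0 ≈⟨ ⊛-sucʳ g f n ⟨
    (g ⊛ f) (suc n)                 ∎

  ⊛-distribˡ-⊕ : ∀ f g h n → (f ⊛ (g ⊕ h)) n ≈ (f ⊛ g) n + (f ⊛ h) n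
  ⊛-distribˡ-⊕ f g h n = trans (sumBelow-cong (suc n) (λ _ _ → distribˡ _ _ _))
                               (sumBelow-+ (λ k → f k * g (n ∸ k)) (λ k → f k * h (n ∸ k)) (suc n))

  ⊛-distribʳ-⊕ : ∀ f g h n → ((f ⊕ g) ⊛ h) n ≈ (f ⊛ h) n + (g ⊛ h) n
  ⊛-distribʳ-⊕ f g h n = trans (sumBelow-cong (suc n) (λ _ _ → distribʳ _ _ _))
                               (sumBelow-+ (λ k → f k * h (n ∸ k)) (λ k → g k * h (n ∸ k)) (suc n))

  ⊛-scaleʳ : ∀ x f g n → (f ⊛ scale x g) n ≈ x * (f ⊛ g) n
  ⊛-scaleʳ x f g n = trans (sumBelow-cong (suc n) (λ _ _ → x∙yz≈y∙xz _ x _))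
                           (sumBelow-distribˡ x (λ k → f k * g (n ∸ k)) (suc n))

  ⊛-scaleˡ : ∀ x f g n → (scale x f ⊛ g) n ≈ x * (f ⊛ g) n
  ⊛-scaleˡ x f g n = trans (sumBelow-cong (suc n) (λ _ _ → *-assoc _ _ _))
                           (sumBelow-distribˡ x (λ k → f k * g (n ∸ k)) (suc n))

  ⊛-negˡ : ∀ f g n → ((λ j → - f j) ⊛ g) n ≈ - (f ⊛ g) n
  ⊛-negˡ f g n = begin
    ((λ j → - f j) ⊛ g) n ≈⟨ ⊛-congʳ g n (λ j _ → -1*x≈-x (f j)) ⟨
    (scale (- 1#) f ⊛ g) n ≈⟨ ⊛-scaleˡ (- 1#) f g n ⟩
    - 1# * (f ⊛ g) n       ≈⟨ -1*x≈-x _ ⟩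
    - (f ⊛ g) n            ∎

  ⊛-negʳ : ∀ f g n → (f ⊛ (λ j → - g j)) n ≈ - (f ⊛ g) n
  ⊛-negʳ f g n = trans (⊛-comm f _ n) (trans (⊛-negˡ g f n) (-‿cong (⊛-comm g f n)))

  ⊛-vanishʳ : ∀ f g n → (∀ k → k ≤ n → g k ≈ 0#) → (f ⊛ g) n ≈ 0#
  ⊛-vanishʳ f g n g≈0 =
    sumBelow-zero (suc n) (λ k k≤n → trans (*-congˡ (g≈0 (n ∸ k) (ℕ.m∸n≤m n k))) (zeroʳ _))

  ⊛-constʳ : ∀ f x n → (f ⊛ const x) n ≈ f n * x
  ⊛-constʳ f x zero    = ⊛-zeroth f (const x)
  ⊛-constʳ f x (suc n) = begin
    (f ⊛ const x) (suc n)                 ≈⟨ ⊛-sucʳ f (const x) n ⟩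
    (f ⊛ tail (const x)) n + f (suc n) * x ≈⟨ +-congʳ (⊛-vanishʳ f (tail (const x)) n (λ _ _ → refl)) ⟩
    0# + f (suc n) * x                    ≈⟨ +-identityˡ _ ⟩
    f (suc n) * x                         ∎

  ⊛-identityʳ : ∀ f n → (f ⊛ one) n ≈ f n
  ⊛-identityʳ f n = trans (⊛-constʳ f 1# n) (*-identityʳ _)

  ⊛-assoc : ∀ f g h n → ((f ⊛ g) ⊛ h) n ≈ (f ⊛ (g ⊛ h)) n
  ⊛-assoc f g h zero = begin
    ((f ⊛ g) ⊛ h) 0   ≈⟨ trans (⊛-zeroth (f ⊛ g) h) (*-congʳ (⊛-zeroth f g)) ⟩
    (f 0 * g 0) * h 0 ≈⟨ *-assoc _ _ _ ⟩
    f 0 * (g 0 * h 0) ≈⟨ trans (⊛-zeroth f (g ⊛ h)) (*-congˡ (⊛-zeroth g h)) ⟨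
    (f ⊛ (g ⊛ h)) 0   ∎
  ⊛-assoc f g h (suc n) = begin
    ((f ⊛ g) ⊛ h) (suc n)
      ≈⟨ ⊛-sucˡ (f ⊛ g) h n ⟩
    (f ⊛ g) 0 * h (suc n) + (tail (f ⊛ g) ⊛ h) n
      ≈⟨ +-cong (*-congʳ (⊛-zeroth f g)) (⊛-congʳ h n (λ k _ → ⊛-sucˡ f g k)) ⟩
    (f 0 * g 0) * h (suc n) + ((scale (f 0) (tail g) ⊕ (tail f ⊛ g)) ⊛ h) n
      ≈⟨ +-congˡ (⊛-distribʳ-⊕ (scale (f 0) (tail g)) (tail f ⊛ g) h n) ⟩
    (f 0 * g 0) * h (suc n) + ((scale (f 0) (tail g) ⊛ h) n + ((tail f ⊛ g) ⊛ h) n)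
      ≈⟨ +-congˡ (+-cong (⊛-scaleˡ (f 0) (tail g) h n) (⊛-assoc (tail f) g h n)) ⟩
    (f 0 * g 0) * h (suc n) + (f 0 * (tail g ⊛ h) n + (tail f ⊛ (g ⊛ h)) n)
      ≈⟨ solve 5 (λ a b c d e → (a :* b) :* c :+ (a :* d :+ e) := a :* (b :* c :+ d) :+ e) refl _ _ _ _ _ ⟩
    f 0 * (g 0 * h (suc n) + (tail g ⊛ h) n) + (tail f ⊛ (g ⊛ h)) n
      ≈⟨ +-congʳ (*-congˡ (⊛-sucˡ g h n)) ⟨
    f 0 * (g ⊛ h) (suc n) + (tail f ⊛ (g ⊛ h)) n
      ≈⟨ ⊛-sucˡ f (g ⊛ h) n ⟨
    (f ⊛ (g ⊛ h)) (suc n) ∎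

  ⊛-sumBelowʳ : ∀ f (G : ℕ → Series) m n →
                (f ⊛ (λ j → sumBelow (λ i → G i j) m)) n ≈ sumBelow (λ i → (f ⊛ G i) n) m
  ⊛-sumBelowʳ f G zero    n = ⊛-vanishʳ f (λ _ → 0#) n (λ _ _ → refl)
  ⊛-sumBelowʳ f G (suc m) n =
    trans (⊛-distribˡ-⊕ f (λ j → sumBelow (λ i → G i j) m) (G m) n) (+-congʳ (⊛-sumBelowʳ f G m n))

  pow-zmul-vanish : ∀ h {m j} → j < m → pow (zmul h) m j ≈ 0#
  pow-zmul-vanish h {suc m} {zero}  _         = trans (⊛-zeroth (zmul h) (pow (zmul h) m)) (zeroˡ _)
  pow-zmul-vanish h {suc m} {suc j} (s≤s j<m) = begin
    pow (zmul h) (suc m) (suc j)                      ≈⟨ ⊛-sucˡ (zmul h) (pow (zmul h) m) j ⟩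
    0# * pow (zmul h) m (suc j) + (h ⊛ pow (zmul h) m) j
      ≈⟨ +-cong (zeroˡ _) (⊛-vanishʳ h (pow (zmul h) m) j
                             (λ k k≤j → pow-zmul-vanish h (ℕ.≤-trans (s≤s k≤j) j<m))) ⟩
    0# + 0#                                           ≈⟨ +-identityˡ 0# ⟩
    0#                                                ∎

  inv1m-zeroth : ∀ h → inv1m h 0 ≈ 1#
  inv1m-zeroth h = +-identityˡ 1#

  inv1m-suc : ∀ h n → inv1m h (suc n) ≈ (h ⊛ inv1m h) n
  inv1m-suc h n = begin
    inv1m h (suc n)
      ≈⟨ sumBelow-head (λ m → pow (zmul h) m (suc n)) (suc n) ⟩
    0# + sumBelow (λ m → pow (zmul h) (suc m) (suc n)) (suc n)
      ≈⟨ +-identityˡ _ ⟩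
    sumBelow (λ m → pow (zmul h) (suc m) (suc n)) (suc n)
      ≈⟨ sumBelow-cong (suc n) (λ m _ → zmul-⊛ (pow (zmul h) m)) ⟩
    sumBelow (λ m → (h ⊛ pow (zmul h) m) n) (suc n)
      ≈⟨ ⊛-sumBelowʳ h (λ m → pow (zmul h) m) (suc n) n ⟨
    (h ⊛ (λ j → sumBelow (λ m → pow (zmul h) m j) (suc n))) n
      ≈⟨ ⊛-congˡ h n (λ j j≤n → sumBelow-truncate (λ m → pow (zmul h) m j) j≤n (λ m → pow-zmul-vanish h)) ⟩
    (h ⊛ inv1m h) n ∎
    where
    zmul-⊛ : ∀ g → (zmul h ⊛ g) (suc n) ≈ (h ⊛ g) n
    zmul-⊛ g = trans (⊛-sucˡ (zmul h) g n) (trans (+-congʳ (zeroˡ _)) (+-identityˡ _))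

  ⊛-inv1m : ∀ f h → f 0 ≈ 1# → (∀ n → f (suc n) ≈ - h n) → ∀ n → (f ⊛ inv1m h) n ≈ one n
  ⊛-inv1m f h f₀≈1 tail-f≈-h zero =
    trans (⊛-zeroth f (inv1m h)) (trans (*-cong f₀≈1 (inv1m-zeroth h)) (*-identityˡ 1#))
  ⊛-inv1m f h f₀≈1 tail-f≈-h (suc n) = begin
    (f ⊛ inv1m h) (suc n)                             ≈⟨ ⊛-sucˡ f (inv1m h) n ⟩
    f 0 * inv1m h (suc n) + (tail f ⊛ inv1m h) n
      ≈⟨ +-cong (*-cong f₀≈1 (inv1m-suc h n)) (⊛-congʳ (inv1m h) n (λ k _ → tail-f≈-h k)) ⟩
    1# * (h ⊛ inv1m h) n + ((λ j → - h j) ⊛ inv1m h) n ≈⟨ +-cong (*-identityˡ _) (⊛-negˡ h (inv1m h) n) ⟩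
    (h ⊛ inv1m h) n + - (h ⊛ inv1m h) n               ≈⟨ -‿inverseʳ _ ⟩
    0#                                                ∎

  recip1-quotient : ∀ D N X n → D 0 ≈ 1# → (∀ k → k ≤ n → (D ⊛ X) k ≈ N k) → (N ⊛ recip1 D) n ≈ X n
  recip1-quotient D N X n D₀≈1 DX≈N = begin
    (N ⊛ recip1 D) n         ≈⟨ ⊛-comm N (recip1 D) n ⟩
    (recip1 D ⊛ N) n         ≈⟨ ⊛-congˡ (recip1 D) n DX≈N ⟨
    (recip1 D ⊛ (D ⊛ X)) n   ≈⟨ ⊛-assoc (recip1 D) D X n ⟨
    ((recip1 D ⊛ D) ⊛ X) n   ≈⟨ ⊛-congʳ X n (λ k _ → trans (⊛-comm (recip1 D) D k) (D⊛recip1D≈1 k)) ⟩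
    (one ⊛ X) n              ≈⟨ ⊛-comm one X n ⟩
    (X ⊛ one) n              ≈⟨ ⊛-identityʳ X n ⟩
    X n                      ∎
    where
    D⊛recip1D≈1 : ∀ k → (D ⊛ recip1 D) k ≈ one k
    D⊛recip1D≈1 = ⊛-inv1m D (λ m → - D (suc m)) D₀≈1 (λ m → sym (-‿involutive _))

  oneMinusZ : Series → Series
  oneMinusZ w zero    = 1#
  oneMinusZ w (suc n) = - w n

  -- T d k is the depth-d truncation of the continued fraction for g (k + 1) / g k.
  module ContinuedFraction
    (g : ℕ → Series) (β α : ℕ → Carrier)
    (g-zeroth : ∀ k → g k 0 ≈ 1#)
    (g-recurrence : ∀ k n → g k (suc n) + (β k * g (suc k) n + α k * g (suc (suc k)) n) ≈ g (suc k) (suc n))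
    (T W : ℕ → ℕ → Series)
    (T-zeroth : ∀ k → T 0 k 0 ≈ 1#)
    (T-suc : ∀ d k n → T (suc d) k n ≈ inv1m (W d k) n)
    (W-unfold : ∀ d k n → W d k n ≈ (const (β k) ⊕ scale (α k) (T d (suc k))) n)
    where

    g-factor : ∀ d k → (∀ m → m ≤ d → (g (suc k) ⊛ T d (suc k)) m ≈ g (suc (suc k)) m) →
               ∀ n → n ≤ suc d → g k n ≈ (g (suc k) ⊛ oneMinusZ (W d k)) n
    g-factor d k _ zero _ = begin
      g k 0                                ≈⟨ trans (g-zeroth k) (sym (g-zeroth (suc k))) ⟩
      g (suc k) 0                          ≈⟨ *-identityʳ _ ⟨
      g (suc k) 0 * 1#                     ≈⟨ ⊛-zeroth (g (suc k)) (oneMinusZ (W d k)) ⟨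
      (g (suc k) ⊛ oneMinusZ (W d k)) 0    ∎
    g-factor d k convergent (suc m) (s≤s m≤d) = begin
      g k (suc m)
        ≈⟨ x≈z//y _ _ _ (g-recurrence k m) ⟩
      G (suc m) − (β k * G m + α k * g (suc (suc k)) m)
        ≈⟨ +-congˡ (-‿cong (+-cong (*-comm _ _) (*-congˡ (convergent m m≤d)))) ⟨
      G (suc m) − (G m * β k + α k * (G ⊛ T d (suc k)) m)
        ≈⟨ +-congˡ (-‿cong (+-cong (⊛-constʳ G (β k) m) (⊛-scaleʳ (α k) G (T d (suc k)) m))) ⟨
      G (suc m) − ((G ⊛ const (β k)) m + (G ⊛ scale (α k) (T d (suc k))) m)
        ≈⟨ +-congˡ (-‿cong (⊛-distribˡ-⊕ G (const (β k)) (scale (α k) (T d (suc k))) m)) ⟨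
      G (suc m) − (G ⊛ (const (β k) ⊕ scale (α k) (T d (suc k)))) m
        ≈⟨ +-congˡ (-‿cong (⊛-congˡ G m (λ j _ → W-unfold d k j))) ⟨
      G (suc m) − (G ⊛ W d k) m
        ≈⟨ +-cong (*-identityʳ _) (⊛-negʳ G (W d k) m) ⟨
      G (suc m) * 1# + (G ⊛ tail (oneMinusZ (W d k))) m
        ≈⟨ trans (⊛-sucʳ G (oneMinusZ (W d k)) m) (+-comm _ _) ⟨
      (G ⊛ oneMinusZ (W d k)) (suc m) ∎
      where
      G : Series
      G = g (suc k)

    convergent : ∀ d k n → n ≤ d → (g k ⊛ T d k) n ≈ g (suc k) n
    convergent zero k zero _ = begin
      (g k ⊛ T 0 k) 0  ≈⟨ ⊛-zeroth (g k) (T 0 k) ⟩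
      g k 0 * T 0 k 0  ≈⟨ *-cong (g-zeroth k) (T-zeroth k) ⟩
      1# * 1#          ≈⟨ *-identityˡ 1# ⟩
      1#               ≈⟨ g-zeroth (suc k) ⟨
      g (suc k) 0      ∎
    convergent (suc d) k n n≤d = begin
      (g k ⊛ T (suc d) k) n
        ≈⟨ ⊛-congʳ (T (suc d) k) n (λ j j≤n → g-factor d k (convergent d (suc k)) j (ℕ.≤-trans j≤n n≤d)) ⟩
      ((G ⊛ E) ⊛ T (suc d) k) n
        ≈⟨ ⊛-assoc G E (T (suc d) k) n ⟩
      (G ⊛ (E ⊛ T (suc d) k)) n
        ≈⟨ ⊛-congˡ G n (λ j _ → trans (⊛-congˡ E j (λ i _ → T-suc d k i))
                                      (⊛-inv1m E (W d k) refl (λ _ → refl) j)) ⟩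
      (G ⊛ one) n
        ≈⟨ ⊛-identityʳ G n ⟩
      G n ∎
      where
      G E : Series
      G = g (suc k)
      E = oneMinusZ (W d k)

  ^-congˡ : ∀ {x y} n → x ≈ y → x ^ n ≈ y ^ n
  ^-congˡ zero    x≈y = refl
  ^-congˡ (suc n) x≈y = *-cong x≈y (^-congˡ n x≈y)

  ^-homo-* : ∀ x m n → x ^ (m +ℕ n) ≈ x ^ m * x ^ n
  ^-homo-* x zero    n = sym (*-identityˡ _)
  ^-homo-* x (suc m) n = trans (*-congˡ (^-homo-* x m n)) (sym (*-assoc _ _ _))

  ^-distrib-* : ∀ x y n → (x * y) ^ n ≈ x ^ n * y ^ n
  ^-distrib-* x y zero    = sym (*-identityˡ 1#)
  ^-distrib-* x y (suc n) = trans (*-congˡ (^-distrib-* x y n))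
    (solve 4 (λ x y a b → (x :* y) :* (a :* b) := (x :* a) :* (y :* b)) refl x y _ _)

  1#^n≈1# : ∀ n → 1# ^ n ≈ 1#
  1#^n≈1# zero    = refl
  1#^n≈1# (suc n) = trans (*-identityˡ _) (1#^n≈1# n)

  prodBelow-cong : ∀ {f g : ℕ → Carrier} n → (∀ k → f k ≈ g k) → prodBelow f n ≈ prodBelow g n
  prodBelow-cong zero    f≈g = refl
  prodBelow-cong (suc n) f≈g = *-cong (prodBelow-cong n f≈g) (f≈g n)

  prodBelow-head : ∀ (f : ℕ → Carrier) n → prodBelow f (suc n) ≈ f 0 * prodBelow (f ∘ suc) n
  prodBelow-head f zero    = trans (*-identityˡ _) (sym (*-identityʳ _))
  prodBelow-head f (suc n) = trans (*-congʳ (prodBelow-head f n)) (*-assoc _ _ _)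

  inverse-unfold : ∀ {x u} → (1# − x) * u ≈ 1# → u ≈ 1# + x * u
  inverse-unfold {x} {u} [1-x]u≈1 = begin
    u                    ≈⟨ *-identityˡ u ⟨
    1# * u               ≈⟨ *-congʳ (//-rightDividesˡ x 1#) ⟨
    ((1# − x) + x) * u   ≈⟨ distribʳ u (1# − x) x ⟩
    (1# − x) * u + x * u ≈⟨ +-congʳ [1-x]u≈1 ⟩
    1# + x * u           ∎

  linear-fixedPoint : ∀ {s v a r} → (1# − s) * v ≈ 1# → a ≈ r + s * a → a ≈ v * r
  linear-fixedPoint {s} {v} {a} {r} [1-s]v≈1 a≈r+sa = begin
    a                  ≈⟨ *-identityˡ a ⟨
    1# * a             ≈⟨ *-congʳ (trans (*-comm v (1# − s)) [1-s]v≈1) ⟨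
    (v * (1# − s)) * a ≈⟨ *-assoc v (1# − s) a ⟩
    v * ((1# − s) * a) ≈⟨ *-congˡ r≈[1-s]a ⟨
    v * r              ∎
    where
    r≈[1-s]a : r ≈ (1# − s) * a
    r≈[1-s]a = begin
      r                  ≈⟨ x≈z//y r (s * a) a (sym a≈r+sa) ⟩
      a − s * a          ≈⟨ +-cong (sym (*-identityˡ a)) (-‿distribˡ-* s a) ⟩
      1# * a + (- s) * a ≈⟨ distribʳ a 1# (- s) ⟨
      (1# − s) * a       ∎

  partial-fraction : ∀ {x y u w v} → (1# − x) * u ≈ 1# → (1# − y) * w ≈ 1# → (1# − x * y) * v ≈ 1# →
                     u * w ≈ v * (w + x * u)
  partial-fraction {x} {y} {u} {w} {v} [1-x]u≈1 [1-y]w≈1 [1-xy]v≈1 = linear-fixedPoint [1-xy]v≈1 (begin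
    u * w                    ≈⟨ *-congʳ (inverse-unfold [1-x]u≈1) ⟩
    (1# + x * u) * w         ≈⟨ solve 3 (λ x u w → (con 1 :+ x :* u) :* w := w :+ x :* u :* w) refl x u w ⟩
    w + x * u * w            ≈⟨ +-congˡ (*-congˡ (inverse-unfold [1-y]w≈1)) ⟩
    w + x * u * (1# + y * w) ≈⟨ solve 4 (λ x y u w → w :+ x :* u :* (con 1 :+ y :* w)
                                                  := (w :+ x :* u) :+ x :* y :* (u :* w)) refl x y u w ⟩
    (w + x * u) + x * y * (u * w) ∎)

  a≈b+d⇒-a+b≈-d : ∀ {a b d} → a ≈ b + d → - a + b ≈ - d
  a≈b+d⇒-a+b≈-d {a} {b} {d} a≈b+d = begin
    - a + b       ≈⟨ +-congʳ (-‿cong a≈b+d) ⟩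
    - (b + d) + b ≈⟨ +-congʳ (⁻¹-anti-homo-∙ b d) ⟩
    (- d − b) + b ≈⟨ //-rightDividesˡ b (- d) ⟩
    - d           ∎

  module Contiguous (c q : Carrier) (ic iq : ℕ → Carrier) where

    invCqAQ : ℕ → ℕ → Carrier
    invCqAQ A n = prodBelow (λ j → ic (A +ℕ j)) n

    -- With ic k = 1/(1 - c q^k) and iq k = 1/(1 - q^(k+1)), phi A B is 1φ1(0; c q^A; q, q^B z).
    phi : ℕ → ℕ → Series
    phi A B n = (- 1#) ^ n * q ^ (n C 2) * invQQ c q ic iq n * invCqAQ A n * (q ^ B) ^ n

    phi-zeroth : ∀ A B → phi A B 0 ≈ 1#
    phi-zeroth A B = trans (*-identityʳ _) (trans (*-identityʳ _) (trans (*-identityʳ _) (*-identityʳ _)))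

    q^C2-suc : ∀ n → q ^ (suc n C 2) ≈ q ^ (n C 2) * q ^ n
    q^C2-suc n = begin
      q ^ (suc n C 2)        ≈⟨ reflexive (≡.cong (q ^_) suc-C2) ⟩
      q ^ (n +ℕ n C 2)       ≈⟨ ^-homo-* q n (n C 2) ⟩
      q ^ n * q ^ (n C 2)    ≈⟨ *-comm _ _ ⟩
      q ^ (n C 2) * q ^ n    ∎
      where
      suc-C2 : suc n C 2 ≡ n +ℕ n C 2
      suc-C2 = ≡.trans (≡.sym (nCk+nC[k+1]≡[n+1]C[k+1] n 1)) (≡.cong (_+ℕ n C 2) (nC1≡n n))

    invCqAQ-suc : ∀ A n → invCqAQ A (suc n) ≈ ic A * invCqAQ (suc A) n
    invCqAQ-suc A n = trans (prodBelow-head (λ j → ic (A +ℕ j)) n)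
      (*-cong (reflexive (≡.cong ic (ℕ.+-identityʳ A)))
              (prodBelow-cong n (λ j → reflexive (≡.cong ic (ℕ.+-suc A j)))))

    phi-suc : ∀ A B n → phi A B (suc n) ≈ - (q ^ B * q ^ n * iq n * ic A * phi (suc A) B n)
    phi-suc A B n = begin
      phi A B (suc n)
        ≈⟨ *-congʳ (*-cong (*-congʳ (*-congˡ (q^C2-suc n))) (invCqAQ-suc A n)) ⟩
      (- 1# * σ) * (ρ * x) * (Q * i) * (t * P) * (y * y^n)
        ≈⟨ solve 10 (λ m σ ρ x Q i t P y Y → (m :* σ) :* (ρ :* x) :* (Q :* i) :* (t :* P) :* (y :* Y)
                                            := m :* (y :* x :* i :* t :* (σ :* ρ :* Q :* P :* Y)))
                 refl (- 1#) σ ρ x Q i t P y y^n ⟩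
      - 1# * (y * x * i * t * phi (suc A) B n)
        ≈⟨ -1*x≈-x _ ⟩
      - (y * x * i * t * phi (suc A) B n) ∎
      where
      σ ρ Q P x i t y y^n : Carrier
      σ = (- 1#) ^ n
      ρ = q ^ (n C 2)
      Q = invQQ c q ic iq n
      P = invCqAQ (suc A) n
      x = q ^ n
      i = iq n
      t = ic A
      y = q ^ B
      y^n = (q ^ B) ^ n

    phi-shiftA : ∀ A B n → ic (suc A) * phi (suc (suc A)) B n ≈ ic (suc A +ℕ n) * phi (suc A) B n
    phi-shiftA A B n = begin
      u * (S * P₂ * Y)   ≈⟨ solve 4 (λ u S P Y → u :* (S :* P :* Y) := S :* (u :* P) :* Y) refl u S P₂ Y ⟩
      S * (u * P₂) * Y   ≈⟨ *-congʳ (*-congˡ (invCqAQ-suc (suc A) n)) ⟨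
      S * (P₁ * v) * Y   ≈⟨ solve 4 (λ v S P Y → S :* (P :* v) :* Y := v :* (S :* P :* Y)) refl v S P₁ Y ⟩
      v * (S * P₁ * Y)   ∎
      where
      S P₁ P₂ Y u v : Carrier
      S = (- 1#) ^ n * q ^ (n C 2) * invQQ c q ic iq n
      P₁ = invCqAQ (suc A) n
      P₂ = invCqAQ (suc (suc A)) n
      Y = (q ^ B) ^ n
      u = ic (suc A)
      v = ic (suc A +ℕ n)

    phi-suc′ : ∀ A B n → phi (suc A) B (suc n) ≈ - (q ^ B * q ^ n * iq n * ic (suc A +ℕ n) * phi (suc A) B n)
    phi-suc′ A B n = begin
      phi (suc A) B (suc n)                                       ≈⟨ phi-suc (suc A) B n ⟩
      - (w * ic (suc A) * phi (suc (suc A)) B n)                  ≈⟨ -‿cong (*-assoc _ _ _) ⟩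
      - (w * (ic (suc A) * phi (suc (suc A)) B n))                ≈⟨ -‿cong (*-congˡ (phi-shiftA A B n)) ⟩
      - (w * (ic (suc A +ℕ n) * phi (suc A) B n))                 ≈⟨ -‿cong (*-assoc _ _ _) ⟨
      - (w * ic (suc A +ℕ n) * phi (suc A) B n)                   ∎
      where
      w : Carrier
      w = q ^ B * q ^ n * iq n

    phi-shiftB : ∀ A B n → phi A (suc B) n ≈ q ^ n * phi A B n
    phi-shiftB A B n = trans (*-congˡ (^-distrib-* q (q ^ B) n)) (x∙yz≈y∙xz _ (q ^ n) _)

    ratio≈ : ∀ X n → (∀ j → j ≤ n → (phi 0 0 ⊛ X) j ≈ phi 1 1 j) → ratio c q ic iq n ≈ X n
    ratio≈ X n phi00⊛X≈phi11 = recip1-quotient (phiDen c q ic iq) (phiNum c q ic iq) X n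
      (trans (phiDen≈phi00 0) (phi-zeroth 0 0))
      (λ j j≤n → trans (⊛-congʳ X j (λ i _ → phiDen≈phi00 i))
                       (trans (phi00⊛X≈phi11 j j≤n) (phi11≈phiNum j)))
      where
      phiDen≈phi00 : ∀ i → phiDen c q ic iq i ≈ phi 0 0 i
      phiDen≈phi00 i = sym (trans (*-congˡ (1#^n≈1# i)) (*-identityʳ _))
      phi11≈phiNum : ∀ j → phi 1 1 j ≈ phiNum c q ic iq j
      phi11≈phiNum j = *-congˡ (^-congˡ j (*-identityʳ q))

    module Expansions (ic-inverse : ∀ k → (1# − c * (q ^ k)) * ic k ≈ 1#)
                      (iq-inverse : ∀ k → (1# − q ^ suc k) * iq k ≈ 1#) where

      ic-inverse-+ : ∀ A n → (1# − (c * q ^ A) * (q * q ^ n)) * ic (suc A +ℕ n) ≈ 1#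
      ic-inverse-+ A n = trans (*-congʳ (+-congˡ (-‿cong (sym cq^[1+A+n]≈)))) (ic-inverse (suc A +ℕ n))
        where
        cq^[1+A+n]≈ : c * q ^ (suc A +ℕ n) ≈ (c * q ^ A) * (q * q ^ n)
        cq^[1+A+n]≈ = trans (*-congˡ (*-congˡ (^-homo-* q A n)))
          (solve 4 (λ c q a b → c :* (q :* (a :* b)) := (c :* a) :* (q :* b)) refl c q _ _)

      ic-inverse-+′ : ∀ A n → (1# − (q * q ^ n) * (c * q ^ A)) * ic (suc A +ℕ n) ≈ 1#
      ic-inverse-+′ A n = trans (*-congʳ (+-congˡ (-‿cong (*-comm _ _)))) (ic-inverse-+ A n)

      module Factors (A B n : ℕ) where
        y x i t u v g : Carrier
        y = q ^ B
        x = q ^ n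
        i = iq n
        t = ic A
        u = ic (suc A)
        v = ic (suc A +ℕ n)
        g = phi (suc A) B n

      phi-contiguous-AB : ∀ A B n →
        phi A B (suc n) + (q ^ B * ic A * ic (suc A)) * phi (suc (suc A)) (suc B) n
        ≈ phi (suc A) (suc B) (suc n)
      phi-contiguous-AB A B n = begin
        phi A B (suc n) + (y * t * u) * phi (suc (suc A)) (suc B) n
          ≈⟨ +-cong (phi-suc A B n) (trans (*-assoc _ _ _)
               (*-congˡ (trans (phi-shiftA A (suc B) n) (*-congˡ (phi-shiftB (suc A) B n))))) ⟩
        - (y * x * i * t * g) + (y * t) * (v * (x * g))
          ≈⟨ a≈b+d⇒-a+b≈-d scalar ⟩
        - (q * y * x * i * v * (x * g))
          ≈⟨ trans (phi-suc′ A (suc B) n) (-‿cong (*-congˡ (phi-shiftB (suc A) B n))) ⟨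
        phi (suc A) (suc B) (suc n) ∎
        where
        open Factors A B n
        scalar : y * x * i * t * g ≈ (y * t) * (v * (x * g)) + q * y * x * i * v * (x * g)
        scalar = begin
          y * x * i * t * g
            ≈⟨ solve 5 (λ y x i t g → y :* x :* i :* t :* g := (y :* x :* g) :* (i :* t)) refl y x i t g ⟩
          (y * x * g) * (i * t)
            ≈⟨ *-congˡ (partial-fraction (iq-inverse n) (ic-inverse A) (ic-inverse-+′ A n)) ⟩
          (y * x * g) * (v * (t + (q * x) * i))
            ≈⟨ solve 7 (λ y x g v t q i → (y :* x :* g) :* (v :* (t :+ (q :* x) :* i))
                                        := (y :* t) :* (v :* (x :* g)) :+ q :* y :* x :* i :* v :* (x :* g))
                     refl y x g v t q i ⟩
          (y * t) * (v * (x * g)) + q * y * x * i * v * (x * g) ∎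

      phi-contiguous-A : ∀ A B n →
        phi A B (suc n) + (c * q ^ (A +ℕ B) * ic A * ic (suc A)) * phi (suc (suc A)) (suc B) n
        ≈ phi (suc A) B (suc n)
      phi-contiguous-A A B n = begin
        phi A B (suc n) + (c * q ^ (A +ℕ B) * t * u) * phi (suc (suc A)) (suc B) n
          ≈⟨ +-cong (phi-suc A B n) (trans (*-assoc _ _ _) (*-cong (*-congʳ (*-congˡ (^-homo-* q A B)))
               (trans (phi-shiftA A (suc B) n) (*-congˡ (phi-shiftB (suc A) B n))))) ⟩
        - (y * x * i * t * g) + (c * (q ^ A * y) * t) * (v * (x * g))
          ≈⟨ a≈b+d⇒-a+b≈-d scalar ⟩
        - (y * x * i * v * g)
          ≈⟨ phi-suc′ A B n ⟨
        phi (suc A) B (suc n) ∎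
        where
        open Factors A B n
        scalar : y * x * i * t * g ≈ (c * (q ^ A * y) * t) * (v * (x * g)) + y * x * i * v * g
        scalar = begin
          y * x * i * t * g
            ≈⟨ solve 5 (λ y x i t g → y :* x :* i :* t :* g := (y :* x :* g) :* (t :* i)) refl y x i t g ⟩
          (y * x * g) * (t * i)
            ≈⟨ *-congˡ (partial-fraction (ic-inverse A) (iq-inverse n) (ic-inverse-+ A n)) ⟩
          (y * x * g) * (v * (i + (c * q ^ A) * t))
            ≈⟨ solve 8 (λ y x g v i c a t → (y :* x :* g) :* (v :* (i :+ (c :* a) :* t))
                                          := (c :* (a :* y) :* t) :* (v :* (x :* g)) :+ y :* x :* i :* v :* g)
                     refl y x g v i c (q ^ A) t ⟩
          (c * (q ^ A * y) * t) * (v * (x * g)) + y * x * i * v * g ∎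

      phi-contiguous-diag : ∀ A n →
        phi A A (suc n) + (bCoef c q ic iq A * phi (suc A) (suc A) n
                           + aCoef c q ic iq (suc A) * phi (suc (suc A)) (suc (suc A)) n)
        ≈ phi (suc A) (suc A) (suc n)
      phi-contiguous-diag A n = begin
        phi A A (suc n) + ((y * t) * phi (suc A) (suc A) n
                           + (c * q ^ suc (2 *ℕ A) * t * u) * phi (suc (suc A)) (suc (suc A)) n)
          ≈⟨ +-cong (phi-suc A A n) (+-cong (*-congˡ (phi-shiftB (suc A) A n)) third) ⟩
        - (y * x * i * t * g) + ((y * t) * (x * g) + (c * (q * (y * y)) * t) * (v * (x * (x * g))))
          ≈⟨ a≈b+d⇒-a+b≈-d scalar ⟩
        - (q * y * x * i * v * (x * g))
          ≈⟨ trans (phi-suc′ A (suc A) n) (-‿cong (*-congˡ (phi-shiftB (suc A) A n))) ⟨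
        phi (suc A) (suc A) (suc n) ∎
        where
        open Factors A A n
        q^[1+2A]≈ : q ^ suc (2 *ℕ A) ≈ q * (y * y)
        q^[1+2A]≈ =
          *-congˡ (trans (^-homo-* q A (A +ℕ 0)) (*-congˡ (reflexive (≡.cong (q ^_) (ℕ.+-identityʳ A)))))
        third : (c * q ^ suc (2 *ℕ A) * t * u) * phi (suc (suc A)) (suc (suc A)) n
                ≈ (c * (q * (y * y)) * t) * (v * (x * (x * g)))
        third = trans (*-assoc _ _ _) (*-cong (*-congʳ (*-congˡ q^[1+2A]≈))
                  (trans (phi-shiftA A (suc (suc A)) n)
                    (*-congˡ (trans (phi-shiftB (suc A) (suc A) n) (*-congˡ (phi-shiftB (suc A) A n))))))
        scalar : y * x * i * t * g
                 ≈ ((y * t) * (x * g) + (c * (q * (y * y)) * t) * (v * (x * (x * g)))) + q * y * x * i * v * (x * g)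
        scalar = begin
          y * x * i * t * g
            ≈⟨ solve 5 (λ y x i t g → y :* x :* i :* t :* g := (y :* x :* g) :* (i :* t)) refl y x i t g ⟩
          (y * x * g) * (i * t)
            ≈⟨ *-congˡ (partial-fraction (iq-inverse n) (ic-inverse A) (ic-inverse-+′ A n)) ⟩
          (y * x * g) * (v * (t + (q * x) * i))
            ≈⟨ solve 7 (λ y x g v t q i → (y :* x :* g) :* (v :* (t :+ (q :* x) :* i))
                                        := (y :* x :* g) :* (v :* t) :+ (y :* x :* g) :* (v :* ((q :* x) :* i)))
                     refl y x g v t q i ⟩
          (y * x * g) * (v * t) + (y * x * g) * (v * ((q * x) * i))
            ≈⟨ +-congʳ (*-congˡ (*-congʳ (inverse-unfold (ic-inverse-+′ A n)))) ⟩
          (y * x * g) * ((1# + ((q * x) * (c * y)) * v) * t) + (y * x * g) * (v * ((q * x) * i))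
            ≈⟨ solve 8 (λ y x g v t q i c →
                   (y :* x :* g) :* ((con 1 :+ ((q :* x) :* (c :* y)) :* v) :* t)
                     :+ (y :* x :* g) :* (v :* ((q :* x) :* i))
                   := ((y :* t) :* (x :* g) :+ (c :* (q :* (y :* y)) :* t) :* (v :* (x :* (x :* g))))
                     :+ q :* y :* x :* i :* v :* (x :* g))
                 refl y x g v t q i c ⟩
          ((y * t) * (x * g) + (c * (q * (y * y)) * t) * (v * (x * (x * g)))) + q * y * x * i * v * (x * g) ∎

      module J = ContinuedFraction
        (λ k → phi k k) (bCoef c q ic iq) (λ k → aCoef c q ic iq (suc k))
        (λ k → phi-zeroth k k) phi-contiguous-diag
        (Jtail (bCoef c q ic iq) (aCoef c q ic iq))
        (λ d k → const (bCoef c q ic iq k)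
                 ⊕ scale (aCoef c q ic iq (suc k)) (Jtail (bCoef c q ic iq) (aCoef c q ic iq) d (suc k)))
        (λ k → inv1m-zeroth (const (bCoef c q ic iq k))) (λ _ _ _ → refl) (λ _ _ _ → refl)

      split2-2* : ∀ m → split2 (2 *ℕ m) ≡ (m , false)
      split2-2* zero = ≡.refl
      split2-2* (suc m) = ≡.trans (≡.cong split2 (ℕ.*-suc 2 m)) (split2-2+ {2 *ℕ m} (split2-2* m))
        where
        split2-2+ : ∀ {n i} → split2 n ≡ (i , false) → split2 (suc (suc n)) ≡ (suc i , false)
        split2-2+ eq rewrite eq = ≡.refl

      lamCoef-odd : ∀ m → lamCoef c q ic iq (suc (2 *ℕ m)) ≡ lamOdd c q ic iq m
      lamCoef-odd m rewrite split2-2* m = ≡.refl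

      lamCoef-even : ∀ m → lamCoef c q ic iq (suc (suc (2 *ℕ m))) ≡ lamEven c q ic iq (suc m)
      lamCoef-even m rewrite split2-2* m = ≡.refl

      S-recurrence : ℕ → ℕ → ℕ → Set ℓ
      S-recurrence k B B′ = ∀ n →
        phi k B (suc n) + (0# * phi (suc k) B′ n + lamCoef c q ic iq (suc k) * phi (suc (suc k)) (suc B) n)
        ≈ phi (suc k) B′ (suc n)

      phi-contiguous-S : ∀ k → S-recurrence k ⌈ k /2⌉ ⌈ suc k /2⌉
      phi-contiguous-S = parity-induction {P = S-recurrence} even odd
        where
        0*x+y≈y : ∀ x y → 0# * x + y ≈ y
        0*x+y≈y x y = trans (+-congʳ (zeroˡ x)) (+-identityˡ y)

        even : ∀ m → S-recurrence (2 *ℕ m) m (suc m)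
        even m n = trans (+-congˡ (trans (0*x+y≈y _ _) (*-congʳ (reflexive (lamCoef-odd m)))))
                         (phi-contiguous-AB (2 *ℕ m) m n)

        odd : ∀ m → S-recurrence (suc (2 *ℕ m)) (suc m) (suc m)
        odd m n = trans (+-congˡ (trans (0*x+y≈y _ _) (*-congʳ (trans (reflexive (lamCoef-even m)) lamEven≈))))
                        (phi-contiguous-A (suc (2 *ℕ m)) (suc m) n)
          where
          3*m+1≡2*m+[1+m] : ∀ m → 3 *ℕ m +ℕ 1 ≡ 2 *ℕ m +ℕ suc m
          3*m+1≡2*m+[1+m] = solve-∀
          lamEven≈ : lamEven c q ic iq (suc m)
                   ≈ c * q ^ (suc (2 *ℕ m) +ℕ suc m) * ic (suc (2 *ℕ m)) * ic (suc (suc (2 *ℕ m)))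
          lamEven≈ = *-cong (*-congʳ (*-congˡ (reflexive (≡.cong (λ e → q ^ suc e) (3*m+1≡2*m+[1+m] m)))))
                            (reflexive (≡.cong ic (ℕ.+-comm (2 *ℕ m) 2)))

      module S = ContinuedFraction
        (λ k → phi k ⌈ k /2⌉) (λ _ → 0#) (λ k → lamCoef c q ic iq (suc k))
        (λ k → phi-zeroth k ⌈ k /2⌉) phi-contiguous-S
        (λ d k → Stail (lamCoef c q ic iq) (suc d) (suc k))
        (λ d k → scale (lamCoef c q ic iq (suc k)) (Stail (lamCoef c q ic iq) (suc d) (suc (suc k))))
        (λ k → inv1m-zeroth (scale (lamCoef c q ic iq (suc k)) one)) (λ _ _ n → refl)
        (λ _ _ n → sym (trans (+-congʳ (const-0# n)) (+-identityˡ _)))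

proposition6p4 : {a ℓ : Level} (R : CommutativeRing a ℓ) →
    let open CommutativeRing R in let open QCF R in
    (c q : Carrier) (ic iq : ℕ → Carrier) →
    (∀ k → (1# − c * (q ^ k)) * ic k ≈ 1#) →
    (∀ k → (1# − q ^ suc k) * iq k ≈ 1#) →
    (∀ n → ratio c q ic iq n ≈ Jfrac (bCoef c q ic iq) (aCoef c q ic iq) n)
    × (∀ n → ratio c q ic iq n ≈ Sfrac (lamCoef c q ic iq) n)
proposition6p4 R c q ic iq ic-inverse iq-inverse =
  (λ n → ratio≈ (Jtail (bCoef c q ic iq) (aCoef c q ic iq) n 0) n (J.convergent n 0)) ,
  (λ n → ratio≈ (Stail (lamCoef c q ic iq) (suc n) 1) n (S.convergent n 0))
  where
  open QCF R
  open Contiguous R c q ic iq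
  open Expansions ic-inverse iq-inverse
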